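{- Let $T$ be a tree with no branching at limit levels. If $\underline C$ is a transitive and coherent ladder system on $T$, then any two $<_T$-incomparable vertices $s,t$ are separated by a finite set in $X_{\underline C}$, i.e. there is a finite $F\subseteq T$ such that every path in $X_{\underline C}$ from $s$ to $t$ meets $F$.
   Context: A tree is a partial order $(T,\leq)$ in which $t^\downarrow=\{s\in T:s<t\}$ is well ordered for every $t$; $ht(t)$ is the order type of $t^\downarrow$; for $\varepsilon<ht(s)$, $s\restriction\varepsilon$ is the unique $r\in s^\downarrow$ with $ht(r)=\varepsilon$. $T$ has no branching at limit levels if $t^\downarrow=s^\downarrow$ implies $t=s$ for all $s,t$ of limit height. A ladder system on $T$ is a family $\underline C=\{C_t:t\in T\}$ with $C_t\subseteq t^\downarrow$ either finite or a cofinal subset of $t^\downarrow$ of order type $\omega$; $supp(\underline C)=\{t:|C_t|=\omega\}$. $X_{\underline C}$ is the graph with vertex set $T$ and edges $\{s,t\}$ for $t\in T$, $s\in C_t$. $\underline C$ is transitive if $C_t\cap s^\downarrow\subseteq C_s$ for all $t$ and $s\in C_t$. A true ladder system is $\underline\eta=(\eta_t:t\in T)$ with $\eta_t=\{t\}$ for $t$ of successor height and $\eta_t$ a cofinal subset of $t^\downarrow$ of order type $\omega$ for $t$ of limit height. $\underline C$ is coherent if (1) $C_s=C_t\cap s^\downarrow$ for all $t\in supp(\underline C)$ and $s\in C_t$ with $|C_s|<\omega$, and there is a true ladder system $\underline\eta$ such that for all $s,t\in supp(\underline C)$ with $s\in C_t$: (2) $\eta_t\cap s^\downarrow$ is an initial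 segment of $\eta_s$, and (3) $C_t\cap r^\downarrow=C_s\cap r^\downarrow$ where $r=s\restriction\big(ht(\max_{<_T}(\eta_t\cap s^\downarrow))+1\big)$. -}

module Defs where

open import Level using (0ℓ)
open import Data.Nat using (ℕ) renaming (_<_ to _<ℕ_)
open import Data.Product using (Σ; ∃; ∃-syntax; _×_; _,_)
open import Data.Sum using (_⊎_)
open import Data.Empty using (⊥)
open import Data.List using (List; []; _∷_)
open import Data.List.Membership.Propositional using (_∈_; _∉_)
open import Data.List.Relation.Unary.Any using (Any)
open import Data.List.Relation.Unary.Unique.Propositional using (Unique)
open import Relation.Nullary using (¬_)
open import Relation.Binary.PropositionalEquality using (_≡_; _≢_)
open import Function.Bundles using (_⇔_)

module _ {T : Set} (_<_ : T → T → Set) where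

  _≤_ : T → T → Set
  x ≤ y = (x ≡ y) ⊎ (x < y)

  IsMax : (T → Set) → T → Set
  IsMax P m = P m × (∀ x → P x → x ≤ m)

  IsMin : (T → Set) → T → Set
  IsMin P m = P m × (∀ x → P x → m ≤ x)

  Below : T → T → Set
  Below t s = s < t

  WellOrderedBelow : T → Set₁
  WellOrderedBelow t =
    (∀ a b → a < t → b < t → (a < b) ⊎ ((a ≡ b) ⊎ (b < a))) ×
    ((P : T → Set) → (∀ x → P x → x < t) → (∃[ x ] P x) → ∃[ m ] IsMin P m)

  IsTree : Set₁
  IsTree = (∀ x → ¬ (x < x)) ×
           (∀ x y z → x < y → y < z → x < z) ×
           (∀ t → WellOrderedBelow t)

  -- ht(t) is a successor ordinal iff t↓ has a maximum
  SuccHeight : T → Set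
  SuccHeight t = ∃[ m ] IsMax (Below t) m

  -- ht(t) is a (nonzero) limit ordinal iff t↓ is nonempty without maximum
  LimitHeight : T → Set
  LimitHeight t = (∃[ x ] (x < t)) × ¬ SuccHeight t

  NoLimitBranching : Set
  NoLimitBranching = ∀ s t → LimitHeight s → LimitHeight t →
                     (∀ x → (x < s) ⇔ (x < t)) → s ≡ t

  Finite : (T → Set) → Set
  Finite P = ∃[ xs ] (∀ x → P x → x ∈ xs)

  CofinalBelow : T → (T → Set) → Set
  CofinalBelow t P = (∀ x → P x → x < t) × (∀ y → y < t → ∃[ x ] (P x × y ≤ x))

  OrderTypeω : (T → Set) → Set
  OrderTypeω P = Σ (ℕ → T) λ f → ((∀ i j → i <ℕ j → f i < f j) × (∀ x → P x ⇔ (∃[ n ] (f n ≡ x))))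

  -- ladder system: C t s means s ∈ C_t
  IsLadderSystem : (T → T → Set) → Set
  IsLadderSystem C = ∀ t → (∀ s → C t s → s < t) ×
                           (Finite (C t) ⊎ (CofinalBelow t (C t) × OrderTypeω (C t)))

  -- t ∈ supp(C)  iff  |C_t| = ω (i.e. C_t is not finite)
  InSupp : (T → T → Set) → T → Set
  InSupp C t = ¬ Finite (C t)

  IsTransitiveLS : (T → T → Set) → Set
  IsTransitiveLS C = ∀ t s → C t s → ∀ x → C t x → x < s → C s x

  -- true ladder system: η t x means x ∈ η_t
  IsTrueLadder : (T → T → Set) → Set
  IsTrueLadder η =
    (∀ t → SuccHeight t → ∀ x → η t x ⇔ (x ≡ t)) ×
    (∀ t → LimitHeight t → CofinalBelow t (η t) × OrderTypeω (η t))

  -- r = s↾(ht(m)+1): the element of s↓ immediately above m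
  ImmSuccBelow : T → T → T → Set
  ImmSuccBelow s m r = (r < s) × (m < r) × (∀ x → x < r → x ≤ m)

  IsCoherent : (T → T → Set) → Set₁
  IsCoherent C =
    (∀ t → InSupp C t → ∀ s → C t s → Finite (C s) →
       ∀ x → C s x ⇔ (C t x × x < s)) ×
    (∃[ η ] (IsTrueLadder η ×
      (∀ s t → InSupp C s → InSupp C t → C t s →
        -- (2) η_t ∩ s↓ is an initial segment of η_s
        ((∀ x → η t x → x < s → η s x) ×
         (∀ x y → η t x → x < s → η s y → y < x → η t y)) ×
        -- (3) with m = max(η_t ∩ s↓) and r = s↾(ht(m)+1): C_t ∩ r↓ = C_s ∩ r↓
        (∀ m → IsMax (λ x → η t x × x < s) m → ∀ r → ImmSuccBelow s m r →
           ∀ x → x < r → C t x ⇔ C s x))))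

  Adj : (T → T → Set) → T → T → Set
  Adj C x y = C y x ⊎ C x y

data Walk {T : Set} (E : T → T → Set) : T → T → Set where
  here : ∀ x → Walk E x x
  step : ∀ {x y z} → E x y → Walk E y z → Walk E x z

vertices : ∀ {T : Set} {E : T → T → Set} {x y : T} → Walk E x y → List T
vertices (here x) = x ∷ []
vertices (step {x = x} _ w) = x ∷ vertices w

IsPath : ∀ {T : Set} {E : T → T → Set} {x y : T} → Walk E x y → Set
IsPath w = Unique (vertices w)

Separates : ∀ {T : Set} → (T → T → Set) → List T → T → T → Set
Separates {T} E F s t = (s ∉ F) × (t ∉ F) ×
  ((w : Walk E s t) → IsPath w → Any (λ v → v ∈ F) (vertices w))

-- Let v be the least point of the branch of s that is not below t, so v↓ ⊆ t↓.  C_v is finite: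
-- otherwise v has limit height and, as there is no branching at limit levels, v would lie on
-- the branch of t.  A path from s to t must eventually leave the cone above v; the first vertex
-- outside is reached from s by a C-descent through the cone, since (by transitivity) a walk
-- inside the cone above a from y to a gives C_y ∩ a↓ ⊆ C_a.  So the end points of these descents
-- separate s from t, and coherence makes them finitely many: a descent from a ∈ supp(C) through
-- b ∈ C_a, once above some e ∈ η_a with v ≤ e, can be re-routed through the finitely many
-- elements of C_a below e, because C_a and C_b agree below the successor of max(η_a ∩ b↓).
module Submission where

open import Defs
open import Axiom.ExcludedMiddle using (ExcludedMiddle)
open import Axiom.DoubleNegationElimination using (em⇒dne)
open import Level using (0ℓ)
open import Data.Nat using (ℕ; zero; suc; _+_; z≤n; s≤s) renaming (_<_ to _<ℕ_; _≤_ to _≤ℕ_)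
import Data.Nat.Properties as ℕ
open import Data.Product using (∃; ∃-syntax; _×_; _,_; proj₁; proj₂)
open import Data.Sum using (_⊎_; inj₁; inj₂; [_,_])
open import Data.Empty using (⊥-elim)
open import Data.List using (List; []; _++_; concatMap; applyUpTo; filter)
open import Data.List.Membership.Propositional using (_∈_; _∉_; lose)
open import Data.List.Membership.Propositional.Properties
  using (∈-++⁺ˡ; ∈-++⁺ʳ; ∈-concatMap⁺; ∈-applyUpTo⁺; ∈-filter⁺; ∈-filter⁻)
open import Data.List.Relation.Unary.Any as Any using (Any; here; there)
open import Relation.Nullary using (¬_; Dec; yes; no; contradiction)
open import Relation.Binary.PropositionalEquality using (_≡_; _≢_; refl; sym; trans; subst)
open import Function using (id)
open import Function.Bundles using (_⇔_; mk⇔; Equivalence)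
open import Induction.WellFounded using (Acc; acc)

open Equivalence using (to; from)

module TreeTheory (em : ExcludedMiddle 0ℓ) {T : Set} (_<_ : T → T → Set) (tree : IsTree _<_) where

  dne : {P : Set} → ¬ ¬ P → P
  dne = em⇒dne em

  Finite-⊆ : {P Q : T → Set} → (∀ {x} → P x → Q x) → Finite _<_ Q → Finite _<_ P
  Finite-⊆ P⊆Q (xs , Q⊆xs) = xs , λ x px → Q⊆xs x (P⊆Q px)

  Finite-∪ : {P Q : T → Set} → Finite _<_ P → Finite _<_ Q → Finite _<_ (λ x → P x ⊎ Q x)
  Finite-∪ (xs , P⊆xs) (ys , Q⊆ys) = xs ++ ys , λ where
    x (inj₁ px) → ∈-++⁺ˡ (P⊆xs x px)
    x (inj₂ qx) → ∈-++⁺ʳ xs (Q⊆ys x qx)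

  Finite-⋃ : {P : T → Set} {Q : T → T → Set} → Finite _<_ P → (∀ c → P c → Finite _<_ (Q c)) →
             Finite _<_ (λ z → ∃[ c ] (P c × Q c z))
  Finite-⋃ {P} {Q} (xs , P⊆xs) Q-finite = concatMap (λ c → members c em) xs , complete
    where
    members : ∀ c → Dec (P c) → List T
    members c (yes pc) = proj₁ (Q-finite c pc)
    members c (no _) = []

    members-complete : ∀ {c z} (d : Dec (P c)) → P c → Q c z → z ∈ members c d
    members-complete {c} {z} (yes pc) _ qcz = proj₂ (Q-finite c pc) z qcz
    members-complete (no ¬pc) pc _ = contradiction pc ¬pc

    complete : ∀ z → ∃[ c ] (P c × Q c z) → z ∈ concatMap (λ c → members c em) xs
    complete z (c , pc , qcz) =
      ∈-concatMap⁺ (λ c → members c em) (lose (P⊆xs c pc) (members-complete em pc qcz))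

  _≼_ : T → T → Set
  _≼_ = _≤_ _<_

  <-irrefl : ∀ x → ¬ x < x
  <-irrefl = proj₁ tree

  <-trans : ∀ {x y z} → x < y → y < z → x < z
  <-trans = proj₁ (proj₂ tree) _ _ _

  ≼-<-trans : ∀ {x y z} → x ≼ y → y < z → x < z
  ≼-<-trans (inj₁ refl) y<z = y<z
  ≼-<-trans (inj₂ x<y) y<z = <-trans x<y y<z

  <-≼-trans : ∀ {x y z} → x < y → y ≼ z → x < z
  <-≼-trans x<y (inj₁ refl) = x<y
  <-≼-trans x<y (inj₂ y<z) = <-trans x<y y<z

  ≼-trans : ∀ {x y z} → x ≼ y → y ≼ z → x ≼ z
  ≼-trans (inj₁ refl) y≼z = y≼z
  ≼-trans (inj₂ x<y) y≼z = inj₂ (<-≼-trans x<y y≼z)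

  ≼-<-asym : ∀ {x y} → x ≼ y → ¬ y < x
  ≼-<-asym {x} x≼y y<x = <-irrefl x (≼-<-trans x≼y y<x)

  least : ∀ {t} (P : T → Set) → (∀ x → P x → x < t) → ∃ P → ∃[ m ] IsMin _<_ P m
  least {t} = proj₂ (proj₂ (proj₂ tree) t)

  ≼-compare : ∀ {a b c} → a ≼ c → b ≼ c → a ≼ b ⊎ b < a
  ≼-compare (inj₁ refl) (inj₁ refl) = inj₁ (inj₁ refl)
  ≼-compare (inj₁ refl) (inj₂ b<a) = inj₂ b<a
  ≼-compare (inj₂ a<b) (inj₁ refl) = inj₁ (inj₂ a<b)
  ≼-compare {a} {b} {c} (inj₂ a<c) (inj₂ b<c) with proj₁ (proj₂ (proj₂ tree) c) a b a<c b<c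
  ... | inj₁ a<b = inj₁ (inj₂ a<b)
  ... | inj₂ (inj₁ a≡b) = inj₁ (inj₁ a≡b)
  ... | inj₂ (inj₂ b<a) = inj₂ b<a

  ⋠⇒≻ : ∀ {a b c} → a ≼ c → b ≼ c → ¬ a ≼ b → b < a
  ⋠⇒≻ a≼c b≼c a⋠b = [ (λ a≼b → contradiction a≼b a⋠b) , id ] (≼-compare a≼c b≼c)

  ⊁⇒≼ : ∀ {a b c} → a ≼ c → b ≼ c → ¬ b < a → a ≼ b
  ⊁⇒≼ a≼c b≼c b⊀a = [ id , (λ b<a → contradiction b<a b⊀a) ] (≼-compare a≼c b≼c)

  <-acc : ∀ a → Acc _<_ a
  <-acc a with em {∃[ x ] (x < a × ¬ Acc _<_ x)}
  ... | no ¬bad = acc λ {y} y<a → dne λ ¬acc-y → ¬bad (y , y<a , ¬acc-y)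
  ... | yes bad with least (λ x → x < a × ¬ Acc _<_ x) (λ _ → proj₁) bad
  ...   | m , (m<a , ¬acc-m) , m-least =
    ⊥-elim (¬acc-m (acc λ {y} y<m → dne λ ¬acc-y → ≼-<-asym (m-least y (<-trans y<m m<a , ¬acc-y)) y<m))

  LimitHeight-resp : ∀ {a b} → (∀ x → (x < a) ⇔ (x < b)) → LimitHeight _<_ a → LimitHeight _<_ b
  LimitHeight-resp a↓≡b↓ ((x , x<a) , a-not-succ) =
    (x , to (a↓≡b↓ x) x<a) ,
    λ (m , m<b , m-max) → a-not-succ (m , from (a↓≡b↓ m) m<b , λ y y<a → m-max y (to (a↓≡b↓ y) y<a))

  limit-below⇒≼ : NoLimitBranching _<_ → ∀ {v t} → LimitHeight _<_ v → (∀ x → x < v → x < t) → v ≼ t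
  limit-below⇒≼ nlb {v} {t} lim-v v↓⊆t↓ with em {∃[ u ] (u < t × ¬ u < v)}
  ... | yes missing with least (λ u → u < t × ¬ u < v) (λ _ → proj₁) missing
  ...   | u , (u<t , u≮v) , u-least = inj₂ (subst (_< t) (sym v≡u) u<t)
    where
    same : ∀ x → (x < v) ⇔ (x < u)
    same x = mk⇔ (λ x<v → ⋠⇒≻ (inj₂ u<t) (inj₂ (v↓⊆t↓ x x<v)) (λ u≼x → u≮v (≼-<-trans u≼x x<v)))
                 (λ x<u → dne λ x≮v → ≼-<-asym (u-least x (<-trans x<u u<t , x≮v)) x<u)

    v≡u : v ≡ u
    v≡u = nlb v u lim-v (LimitHeight-resp same lim-v) same
  limit-below⇒≼ nlb {v} {t} lim-v v↓⊆t↓ | no ¬missing =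
    inj₁ (nlb v t lim-v (LimitHeight-resp same lim-v) same)
    where
    same : ∀ x → (x < v) ⇔ (x < t)
    same x = mk⇔ (v↓⊆t↓ x) (λ x<t → dne λ x≮v → ¬missing (x , x<t , x≮v))

  record BranchPoint (s t : T) : Set where
    field
      v     : T
      v≼s   : v ≼ s
      v⋠t   : ¬ v ≼ t
      v↓⊆t↓ : ∀ x → x < v → x < t

  branch-point : ∀ {s t} → ¬ s ≼ t → ¬ t < s → BranchPoint s t
  branch-point {s} {t} s⋠t t≮s = choose em
    where
    strict : ∀ {x} → x < s → x ≼ t → x < t
    strict x<s (inj₁ refl) = contradiction x<s t≮s
    strict _ (inj₂ x<t) = x<t

    choose : Dec (∃[ x ] (x < s × ¬ x ≼ t)) → BranchPoint s t
    choose (yes outside) =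
      let (m , (m<s , m⋠t) , m-least) = least (λ x → x < s × ¬ x ≼ t) (λ _ → proj₁) outside
      in record
        { v = m ; v≼s = inj₂ m<s ; v⋠t = m⋠t
        ; v↓⊆t↓ = λ x x<m → strict (<-trans x<m m<s)
                    (dne λ x⋠t → ≼-<-asym (m-least x (<-trans x<m m<s , x⋠t)) x<m) }
    choose (no ¬outside) = record
      { v = s ; v≼s = inj₁ refl ; v⋠t = s⋠t
      ; v↓⊆t↓ = λ x x<s → strict x<s (dne λ x⋠t → ¬outside (x , x<s , x⋠t)) }

  immediate-successor : ∀ {b m} → ¬ SuccHeight _<_ b → m < b → ∃[ r ] ImmSuccBelow _<_ b m r
  immediate-successor {b} {m} b-not-succ m<b with em {∃[ x ] (x < b × m < x)}
  ... | no ¬above =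
    contradiction (m , m<b , λ x x<b → ⊁⇒≼ (inj₂ x<b) (inj₂ m<b) (λ m<x → ¬above (x , x<b , m<x))) b-not-succ
  ... | yes above with least (λ x → x < b × m < x) (λ _ → proj₁) above
  ...   | r , (r<b , m<r) , r-least = r , r<b , m<r ,
    λ x x<r → ⊁⇒≼ (inj₂ (<-trans x<r r<b)) (inj₂ m<b)
                  (λ m<x → ≼-<-asym (r-least x (<-trans x<r r<b , m<x)) x<r)

  Increasing : (ℕ → T) → Set
  Increasing f = ∀ i j → i <ℕ j → f i < f j

  module _ {f : ℕ → T} (f↑ : Increasing f) where

    increasing-mono : ∀ {i j} → i ≤ℕ j → f i ≼ f j
    increasing-mono {i} {j} i≤j with ℕ.m≤n⇒m<n∨m≡n i≤j
    ... | inj₁ i<j = inj₂ (f↑ i j i<j)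
    ... | inj₂ refl = inj₁ refl

    increasing-reflect : ∀ {i j} → f i ≼ f j → i ≤ℕ j
    increasing-reflect {i} {j} fi≼fj = ℕ.≮⇒≥ λ j<i → ≼-<-asym fi≼fj (f↑ j i j<i)

    last-below : ∀ {b} n → f 0 < b → ¬ f n < b → ∃[ i ] (f i < b × ¬ f (suc i) < b)
    last-below zero f0<b f0≮b = contradiction f0<b f0≮b
    last-below {b} (suc n) f0<b fsn≮b with em {f n < b}
    ... | yes fn<b = n , fn<b , fsn≮b
    ... | no fn≮b = last-below n f0<b fn≮b

  IsLadder : T → (T → Set) → Set
  IsLadder a P = CofinalBelow _<_ a P × OrderTypeω _<_ P

  ladder⇒limit : ∀ {a P} → IsLadder a P → LimitHeight _<_ a
  ladder⇒limit {a} {P} ((P⊆a↓ , cofinal) , f , f↑ , P≡range) = (f 0 , P⊆a↓ _ (in-P 0)) , not-succ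
    where
    in-P : ∀ n → P (f n)
    in-P n = from (P≡range (f n)) (n , refl)

    not-succ : ¬ SuccHeight _<_ a
    not-succ (m , m<a , m-max) with cofinal m m<a
    ... | x , px , m≼x with to (P≡range x) px
    ... | n , refl =
      ≼-<-asym (≼-trans (m-max _ (P⊆a↓ _ (in-P (suc n)))) m≼x) (f↑ n (suc n) (ℕ.n<1+n n))

  ladder-finite-below : ∀ {a P e} → IsLadder a P → e < a → Finite _<_ (λ x → P x × x ≼ e)
  ladder-finite-below {e = e} ((_ , cofinal) , f , f↑ , P≡range) e<a with cofinal e e<a
  ... | x , px , e≼x with to (P≡range x) px
  ... | n , refl = applyUpTo f (suc n) , λ y (py , y≼e) → early y (to (P≡range y) py) y≼e
    where
    early : ∀ y → ∃[ i ] (f i ≡ y) → y ≼ e → y ∈ applyUpTo f (suc n)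
    early _ (i , refl) fi≼e = ∈-applyUpTo⁺ f (s≤s (increasing-reflect f↑ (≼-trans fi≼e e≼x)))

  ladder-max-below : ∀ {a P b e} → IsLadder a P → b < a → P e → e < b →
                     ∃[ m ] IsMax _<_ (λ x → P x × x < b) m
  ladder-max-below {P = P} {b = b} ((_ , cofinal) , f , f↑ , P≡range) b<a pe e<b
    with cofinal b b<a | to (P≡range _) pe
  ... | x , px , b≼x | k , refl with to (P≡range x) px
  ... | N , refl with last-below f↑ N (≼-<-trans (increasing-mono f↑ z≤n) e<b) (≼-<-asym b≼x)
  ... | i , fi<b , fsi≮b = f i , (from (P≡range (f i)) (i , refl) , fi<b) , maximal
    where
    maximal : ∀ y → P y × y < b → y ≼ f i
    maximal y (py , y<b) with to (P≡range y) py
    ... | j , refl = increasing-mono f↑ (ℕ.≮⇒≥ λ i<j → fsi≮b (≼-<-trans (increasing-mono f↑ i<j) y<b))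

module LadderSystem (em : ExcludedMiddle 0ℓ) {T : Set} (_<_ : T → T → Set) (tree : IsTree _<_)
                    (C : T → T → Set) (ladder : IsLadderSystem _<_ C) (transitive : IsTransitiveLS _<_ C)
  where

  open TreeTheory em _<_ tree

  C⊆↓ : ∀ {t s} → C t s → s < t
  C⊆↓ {t} {s} = proj₁ (ladder t) s

  supp⇒ladder : ∀ {a} → InSupp _<_ C a → IsLadder a (C a)
  supp⇒ladder {a} a∈supp = [ (λ finite → contradiction finite a∈supp) , id ] (proj₂ (ladder a))

  supp⇒limit : ∀ {a} → InSupp _<_ C a → LimitHeight _<_ a
  supp⇒limit a∈supp = ladder⇒limit (supp⇒ladder a∈supp)

  _~_ : T → T → Set
  _~_ = Adj _<_ C

  ~-sym : ∀ {x y} → x ~ y → y ~ x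
  ~-sym (inj₁ c) = inj₂ c
  ~-sym (inj₂ c) = inj₁ c

  data ConeWalk (a : T) : T → T → Set where
    nil  : ∀ {x} → a ≼ x → ConeWalk a x x
    cons : ∀ {x y z} → a ≼ x → x ~ y → ConeWalk a y z → ConeWalk a x z

  length : ∀ {a x y} → ConeWalk a x y → ℕ
  length (nil _) = zero
  length (cons _ _ w) = suc (length w)

  start-above : ∀ {a x y} → ConeWalk a x y → a ≼ x
  start-above (nil a≼x) = a≼x
  start-above (cons a≼x _ _) = a≼x

  end-above : ∀ {a x y} → ConeWalk a x y → a ≼ y
  end-above (nil a≼y) = a≼y
  end-above (cons _ _ w) = end-above w

  reverseOnto : ∀ {a x y z} → ConeWalk a x y → ConeWalk a x z → ConeWalk a y z
  reverseOnto (nil _) u = u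
  reverseOnto (cons _ e w) u = reverseOnto w (cons (start-above w) (~-sym e) u)

  length-reverseOnto : ∀ {a x y z} (w : ConeWalk a x y) (u : ConeWalk a x z) →
                       length (reverseOnto w u) ≡ length w + length u
  length-reverseOnto (nil _) u = refl
  length-reverseOnto (cons _ e w) u = trans (length-reverseOnto w _) (ℕ.+-suc (length w) (length u))

  record FirstReturn (a y x : T) (n : ℕ) : Set where
    field
      u w           : T
      above         : ConeWalk y x u
      edge          : u ~ w
      w≼y           : w ≼ y
      rest          : ConeWalk a w a
      above-shorter : length above <ℕ n
      rest-shorter  : length rest <ℕ n

  first-return : ∀ {a x y} → a ≼ y → y < x → (w : ConeWalk a x a) → FirstReturn a y x (length w)
  first-return a≼y y<a (nil _) = contradiction y<a (≼-<-asym a≼y)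
  first-return {x = x} {y} a≼y y<x (cons {y = x′} _ e w) with em {x′ ≼ y}
  ... | yes x′≼y = record
    { u = x ; w = x′ ; above = nil (inj₂ y<x) ; edge = e ; w≼y = x′≼y ; rest = w
    ; above-shorter = ℕ.0<1+n ; rest-shorter = ℕ.n<1+n (length w) }
  ... | no x′⋠y = record
    { u = u ; w = w′ ; above = cons (inj₂ y<x) e above ; edge = edge ; w≼y = w≼y ; rest = rest
    ; above-shorter = s≤s above-shorter ; rest-shorter = ℕ.m<n⇒m<1+n rest-shorter }
    where
    y<x′ : x ~ x′ → y < x′
    y<x′ (inj₁ x∈Cx′) = <-trans y<x (C⊆↓ x∈Cx′)
    y<x′ (inj₂ x′∈Cx) = ⋠⇒≻ (inj₂ (C⊆↓ x′∈Cx)) (inj₂ y<x) x′⋠y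

    open FirstReturn (first-return a≼y (y<x′ e) w) renaming (w to w′)

  cone-walk-inherits′ : ∀ n {a y} (w : ConeWalk a y a) → length w <ℕ n → ∀ {z} → C y z → z < a → C a z
  cone-walk-inherits′ _ (nil _) _ y→z _ = y→z
  cone-walk-inherits′ (suc n) {y = y} (cons _ (inj₂ y→x) w) (s≤s w<n) y→z z<a =
    cone-walk-inherits′ n w w<n (transitive y _ y→x _ y→z (<-≼-trans z<a (start-above w))) z<a
  cone-walk-inherits′ (suc n) {a} {y} (cons a≼y (inj₁ x→y) w) (s≤s w<n) {z} y→z z<a =
    cone-walk-inherits′ n rest (ℕ.<-trans rest-shorter w<n) (returned w≼y) z<a
    where
    open FirstReturn (first-return a≼y (C⊆↓ x→y) w) renaming (w to r)

    u→r : r < y → C u r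
    u→r r<y with edge
    ... | inj₁ r→u = contradiction (<-trans (C⊆↓ r→u) r<y) (≼-<-asym (end-above above))
    ... | inj₂ u→r = u→r

    back : ConeWalk y u y
    back = reverseOnto above (cons (inj₂ (C⊆↓ x→y)) (inj₂ x→y) (nil (inj₁ refl)))

    back-short : length back <ℕ n
    back-short rewrite length-reverseOnto above (cons (inj₂ (C⊆↓ x→y)) (inj₂ x→y) (nil (inj₁ refl)))
                     | ℕ.+-comm (length above) 1 = ℕ.<-≤-trans (s≤s above-shorter) w<n

    returned : r ≼ y → C r z
    returned (inj₁ r≡y) = subst (λ q → C q z) (sym r≡y) y→z
    returned (inj₂ r<y) =
      transitive y r (cone-walk-inherits′ n back back-short (u→r r<y) r<y) z y→z
                 (<-≼-trans z<a (start-above rest))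

  cone-walk-inherits : ∀ {a y z} → ConeWalk a y a → C y z → z < a → C a z
  cone-walk-inherits w = cone-walk-inherits′ (suc (length w)) w (ℕ.n<1+n (length w))

module Separation (em : ExcludedMiddle 0ℓ) {T : Set} (_<_ : T → T → Set) (tree : IsTree _<_)
                  (nlb : NoLimitBranching _<_) (C : T → T → Set) (ladder : IsLadderSystem _<_ C)
                  (transitive : IsTransitiveLS _<_ C) (coherent : IsCoherent _<_ C)
                  {s t : T} (s≢t : s ≢ t) (s≮t : ¬ s < t) (t≮s : ¬ t < s)
  where

  open TreeTheory em _<_ tree
  open LadderSystem em _<_ tree C ladder transitive

  Supp : T → Set
  Supp = InSupp _<_ C

  coherent-finite : ∀ {a b} → Supp a → C a b → Finite _<_ (C b) → ∀ x → C b x ⇔ (C a x × x < b)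
  coherent-finite {a} {b} a∈supp = proj₁ coherent a a∈supp b

  η : T → T → Set
  η = proj₁ (proj₂ coherent)

  η-ladder : ∀ {a} → Supp a → IsLadder a (η a)
  η-ladder a∈supp = proj₂ (proj₁ (proj₂ (proj₂ coherent))) _ (supp⇒limit a∈supp)

  η-below : ∀ {a e} → Supp a → η a e → e < a
  η-below a∈supp ηae = proj₁ (proj₁ (η-ladder a∈supp)) _ ηae

  coherent-initial : ∀ {a b} → Supp a → Supp b → C a b → ∀ {x} → η a x → x < b → η b x
  coherent-initial {a} {b} a∈supp b∈supp a→b =
    proj₁ (proj₁ (proj₂ (proj₂ (proj₂ coherent)) b a b∈supp a∈supp a→b)) _

  coherent-agree : ∀ {a b} → Supp a → Supp b → C a b → ∀ m → IsMax _<_ (λ x → η a x × x < b) m →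
                   ∀ r → ImmSuccBelow _<_ b m r → ∀ x → x < r → C a x ⇔ C b x
  coherent-agree {a} {b} a∈supp b∈supp a→b = proj₂ (proj₂ (proj₂ (proj₂ coherent)) b a b∈supp a∈supp a→b)

  open BranchPoint (branch-point [ s≢t , s≮t ] t≮s)

  Cᵥ-finite : Finite _<_ (C v)
  Cᵥ-finite = dne λ infinite → v⋠t (limit-below⇒≼ nlb (supp⇒limit infinite) v↓⊆t↓)

  data Exit (a : T) : T → Set where
    drop    : ∀ {z} → C a z → z < v → Exit a z
    descend : ∀ {b z} → C a b → v ≼ b → Exit b z → Exit a z

  Exit⇒< : ∀ {a z} → Exit a z → z < a
  Exit⇒< (drop a→z _) = C⊆↓ a→z
  Exit⇒< (descend a→b _ exit) = <-trans (Exit⇒< exit) (C⊆↓ a→b)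

  ExitVia : (T → Set) → T → Set
  ExitVia P z = P z ⊎ ∃[ c ] ((P c × v ≼ c) × Exit c z)

  ExitVia-mono : ∀ {P Q : T → Set} → (∀ {x} → P x → Q x) → ∀ {z} → ExitVia P z → ExitVia Q z
  ExitVia-mono P⊆Q (inj₁ pz) = inj₁ (P⊆Q pz)
  ExitVia-mono P⊆Q (inj₂ (c , (pc , v≼c) , exit)) = inj₂ (c , (P⊆Q pc , v≼c) , exit)

  ExitVia-finite : ∀ {P} → Finite _<_ P → (∀ c → P c → v ≼ c → Finite _<_ (Exit c)) → Finite _<_ (ExitVia P)
  ExitVia-finite P-finite Exit-finite =
    Finite-∪ P-finite (Finite-⋃ (Finite-⊆ proj₁ P-finite) λ c (pc , v≼c) → Exit-finite c pc v≼c)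

  -- With m = max(η_a ∩ b↓) and r its successor below b, or r = b when C_b is finite.
  record Agreement (a b e : T) : Set where
    field
      r      : T
      e<r    : e < r
      r≼b    : r ≼ b
      agree  : ∀ {x} → x < r → C b x → C a x
      deeper : r < b → Supp b × η b e

  agreement : ∀ {a b e} → Supp a → η a e → C a b → e < b → Agreement a b e
  agreement {a} {b} {e} a∈supp ηae a→b e<b with em {Finite _<_ (C b)}
  ... | yes finite = record
    { r = b ; e<r = e<b ; r≼b = inj₁ refl
    ; agree = λ _ b→x → proj₁ (to (coherent-finite a∈supp a→b finite _) b→x)
    ; deeper = λ b<b → contradiction b<b (<-irrefl b) }
  ... | no b∈supp with ladder-max-below (η-ladder a∈supp) (C⊆↓ a→b) ηae e<b
  ...   | m , m-max with immediate-successor (proj₂ (supp⇒limit b∈supp)) (proj₂ (proj₁ m-max))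
  ...     | r , r-succ = record
    { r = r ; e<r = ≼-<-trans (proj₂ m-max e (ηae , e<b)) (proj₁ (proj₂ r-succ)) ; r≼b = inj₂ (proj₁ r-succ)
    ; agree = λ x<r → from (coherent-agree a∈supp b∈supp a→b m m-max r r-succ _ x<r)
    ; deeper = λ _ → b∈supp , coherent-initial a∈supp b∈supp a→b ηae e<b }

  exit-via-child : ∀ b → Acc _<_ b → ∀ {a e z} → Supp a → η a e → v ≼ e → C a b → v ≼ b →
                   Exit b z → ExitVia (λ x → C a x × x ≼ e) z
  exit-via-child b (acc below-b) {a} {e} a∈supp ηae v≼e a→b v≼b exit with em {b ≼ e}
  ... | yes b≼e = inj₂ (b , ((a→b , b≼e) , v≼b) , exit)
  ... | no b⋠e = via exit
    where
    open Agreement (agreement a∈supp ηae a→b (⋠⇒≻ (inj₂ (C⊆↓ a→b)) (inj₂ (η-below a∈supp ηae)) b⋠e))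

    via : ∀ {z} → Exit b z → ExitVia (λ x → C a x × x ≼ e) z
    via {z} (drop b→z z<v) = inj₁ (agree (<-trans z<e e<r) b→z , inj₂ z<e)
      where
      z<e : z < e
      z<e = <-≼-trans z<v v≼e
    via (descend {c} b→c v≼c exit-c) with ≼-compare r≼b (inj₂ (C⊆↓ b→c))
    ... | inj₂ c<r = exit-via-child c (below-b (C⊆↓ b→c)) a∈supp ηae v≼e (agree c<r b→c) v≼c exit-c
    ... | inj₁ r≼c =
      let (b∈supp , ηbe) = deeper (≼-<-trans r≼c (C⊆↓ b→c))
      in ExitVia-mono (λ (b→x , x≼e) → agree (≼-<-trans x≼e e<r) b→x , x≼e)
                      (exit-via-child c (below-b (C⊆↓ b→c)) b∈supp ηbe v≼e b→c v≼c exit-c)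

  v<supp : ∀ {a} → v ≼ a → Supp a → v < a
  v<supp v≼a a∈supp = [ (λ { refl → contradiction Cᵥ-finite a∈supp }) , id ] v≼a

  exit-cover : ∀ {a} → v ≼ a →
               ∃[ P ] (Finite _<_ P × (∀ {x} → P x → C a x) × (∀ {z} → Exit a z → ExitVia P z))
  exit-cover {a} v≼a with em {Finite _<_ (C a)}
  ... | yes finite = C a , finite , id , λ where
    (drop a→z _) → inj₁ a→z
    (descend a→b v≼b exit) → inj₂ (_ , (a→b , v≼b) , exit)
  ... | no a∈supp with proj₂ (proj₁ (η-ladder a∈supp)) v (v<supp v≼a a∈supp)
  ...   | e , ηae , v≼e =
    (λ x → C a x × x ≼ e) , ladder-finite-below (supp⇒ladder a∈supp) (η-below a∈supp ηae) , proj₁ , cover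
    where
    cover : ∀ {z} → Exit a z → ExitVia (λ x → C a x × x ≼ e) z
    cover (drop a→z z<v) = inj₁ (a→z , inj₂ (<-≼-trans z<v v≼e))
    cover (descend a→b v≼b exit) = exit-via-child _ (<-acc _) a∈supp ηae v≼e a→b v≼b exit

  Exit-finite : ∀ a → Acc _<_ a → v ≼ a → Finite _<_ (Exit a)
  Exit-finite a (acc below-a) v≼a with exit-cover v≼a
  ... | P , P-finite , P⊆Ca , cover =
    Finite-⊆ cover (ExitVia-finite P-finite λ c pc v≼c → Exit-finite c (below-a (C⊆↓ (P⊆Ca pc))) v≼c)

  Any-start : ∀ {E : T → T → Set} {P : T → Set} {x y} (w : Walk E x y) → P x → Any P (vertices w)
  Any-start (here _) px = here px
  Any-start (step _ _) px = here px

  walk-meets-Exit : ∀ {x a} (w : Walk _~_ x t) → v ≼ a → ConeWalk a x a → Any (Exit a) (vertices w)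
  walk-meets-Exit (here _) v≼a cone = contradiction (≼-trans v≼a (start-above cone)) v⋠t
  walk-meets-Exit {x} {a} (step {y = y} e w) v≼a cone with em {a ≼ y}
  ... | yes a≼y = there (walk-meets-Exit w v≼a (cons a≼y (~-sym e) cone))
  ... | no a⋠y = there (leave e)
    where
    leave : x ~ y → Any (Exit a) (vertices w)
    leave (inj₁ y→x) = contradiction (inj₂ (≼-<-trans (start-above cone) (C⊆↓ y→x))) a⋠y
    leave (inj₂ x→y) = enter em
      where
      y<a : y < a
      y<a = ⋠⇒≻ (start-above cone) (inj₂ (C⊆↓ x→y)) a⋠y

      a→y : C a y
      a→y = cone-walk-inherits cone x→y y<a

      enter : Dec (y < v) → Any (Exit a) (vertices w)
      enter (yes y<v) = Any-start w (drop a→y y<v)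
      enter (no y≮v) = Any.map (descend a→y v≼y) (walk-meets-Exit w v≼y (nil (inj₁ refl)))
        where
        v≼y : v ≼ y
        v≼y = ⊁⇒≼ v≼a (inj₂ y<a) y≮v

  separator : ∃[ F ] Separates _~_ F s t
  separator = filter outside exits , s∉F , t∉F , meets
    where
    exits : List T
    exits = proj₁ (Exit-finite s (<-acc s) v≼s)

    outside : ∀ x → Dec (x ≢ s × x ≢ t)
    outside _ = em

    s∉F : s ∉ filter outside exits
    s∉F s∈F = proj₁ (proj₂ (∈-filter⁻ outside {xs = exits} s∈F)) refl

    t∉F : t ∉ filter outside exits
    t∉F t∈F = proj₂ (proj₂ (∈-filter⁻ outside {xs = exits} t∈F)) refl

    selected : ∀ {z} → Exit s z → z ∈ filter outside exits
    selected exit = ∈-filter⁺ outside (proj₂ (Exit-finite s (<-acc s) v≼s) _ exit)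
                      ((λ { refl → <-irrefl _ (Exit⇒< exit) }) , (λ { refl → t≮s (Exit⇒< exit) }))

    meets : (w : Walk _~_ s t) → IsPath w → Any (_∈ filter outside exits) (vertices w)
    meets w _ = Any.map selected (walk-meets-Exit w v≼s (nil (inj₁ refl)))

lemma3 : ExcludedMiddle 0ℓ →
    (T : Set) (_<_ : T → T → Set) → IsTree _<_ → NoLimitBranching _<_ →
    (C : T → T → Set) → IsLadderSystem _<_ C → IsTransitiveLS _<_ C → IsCoherent _<_ C →
    (s t : T) → s ≢ t → ¬ (s < t) → ¬ (t < s) →
    ∃[ F ] Separates (Adj _<_ C) F s t
lemma3 em T _<_ tree nlb C ladder transitive coherent s t s≢t s≮t t≮s =
  Separation.separator em _<_ tree nlb C ladder transitive coherent s≢t s≮t t≮s
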